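{- Let $t \ge 3$ and $m, n \ge 1$ be integers. Then $M_t(K_{m,n})$ is a distance magic graph if and only if $m = n = 2$.
   Context: $K_{m,n}$ is the complete bipartite graph with parts of sizes $m$ and $n$. For a graph $G=(V,E)$ and an integer $t \ge 1$, the generalised Mycielskian $M_t(G)$ is the graph with vertex set $(V \times \{0,1,\dots,t-1\}) \cup \{u\}$ (where $u$ is a new vertex), whose edges are: $(x,0)(y,0)$ for every edge $xy \in E$; $(x,i)(y,i+1)$ for every $0 \le i \le t-2$ and every ordered pair $(x,y)$ with $xy \in E$; and $(x,t-1)u$ for every $x \in V$. A graph $H$ on $N$ vertices is distance magic if there is a bijection $f: V(H) \to \{1,2,\dots,N\}$ and a constant $k$ such that for every vertex $v$, $\sum_{w \in N(v)} f(w) = k$, where $N(v)$ is the open neighbourhood of $v$. -}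

module Defs where

open import Data.Nat using (ℕ; zero; suc; _+_; _*_; _<_; _≤_; _≟_)
open import Data.Bool using (Bool; true; false; _∧_; _∨_; not; if_then_else_)
open import Data.Fin using (Fin; toℕ; splitAt; remQuot; _<?_)
open import Data.Fin.Properties using () renaming (_≟_ to _≟F_)
open import Data.Sum using (_⊎_; inj₁; inj₂)
open import Data.Product using (_×_; _,_; Σ; ∃)
open import Data.List using (List; map; filter; allFin)
open import Data.Nat.ListAction using (sum)
open import Function.Bundles using (_⤖_; Bijection)
open import Relation.Nullary.Decidable using (⌊_⌋; does)
open import Relation.Binary.PropositionalEquality using (_≡_)
open import Relation.Unary using (Pred)

nbrSum : (N : ℕ) → (Fin N → Fin N → Bool) → (Fin N → ℕ) → Fin N → ℕ
nbrSum N adj g v = sum (map g (filter (λ w → adj v w Data.Bool.≟ true) (allFin N)))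

-- Distance magic: a bijection f : V → {1,…,N} (encoded as Fin N, label = toℕ + 1)
-- and a constant k with every open-neighbourhood label sum equal to k.
DistanceMagic : (N : ℕ) → (Fin N → Fin N → Bool) → Set
DistanceMagic N adj =
  Σ (Fin N ⤖ Fin N) λ f → ∃ λ k →
    ∀ v → nbrSum N adj (λ w → suc (toℕ (Bijection.to f w))) v ≡ k

-- Bare adjacency data (without the symmetry/irreflexivity proofs)

Kadj : (m n : ℕ) → Fin (m + n) → Fin (m + n) → Bool
Kadj m n x y with splitAt m x | splitAt m y
... | inj₁ _ | inj₂ _ = true
... | inj₂ _ | inj₁ _ = true
... | _      | _      = false

-- Vertex set Fin (n * t + 1): the first n * t vertices encode (x , i) via
-- remQuot (x : Fin n, level i : Fin t); the last vertex is u.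
data MVertex (n t : ℕ) : Set where
  lay : Fin n → Fin t → MVertex n t
  top : MVertex n t

decodeM : (n t : ℕ) → Fin (n * t + 1) → MVertex n t
decodeM n t z with splitAt (n * t) z
... | inj₂ _ = top
... | inj₁ p with remQuot {n} t p
...   | x , i = lay x i

MadjV : (n t : ℕ) → (Fin n → Fin n → Bool) → MVertex n t → MVertex n t → Bool
MadjV n t a (lay x i) (lay y j) =
     (a x y ∧ (⌊ toℕ i ≟ 0 ⌋ ∧ ⌊ toℕ j ≟ 0 ⌋))
  ∨ (a x y ∧ (⌊ suc (toℕ i) ≟ toℕ j ⌋ ∨ ⌊ suc (toℕ j) ≟ toℕ i ⌋))
MadjV n t a (lay x i) top = ⌊ suc (toℕ i) ≟ t ⌋
MadjV n t a top (lay y j) = ⌊ suc (toℕ j) ≟ t ⌋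
MadjV n t a top top = false

Madj : (n t : ℕ) → (Fin n → Fin n → Bool) → Fin (n * t + 1) → Fin (n * t + 1) → Bool
Madj n t a z w = MadjV n t a (decodeM n t z) (decodeM n t w)

MK : (t m n : ℕ) → Fin ((m + n) * t + 1) → Fin ((m + n) * t + 1) → Bool
MK t m n = Madj (m + n) t (Kadj m n)

{-# OPTIONS --safe #-}
-- Write A_c and B_c for the label sums of level c in the two parts and U for the label of the apex.
-- A vertex of level c in one part sees the other part at levels c - 1 and c + 1 (and at level 0 when c = 0),
-- and sees the apex when c is the last level; so the sequences A and B satisfy A_c + A_(c+2) = k, with
-- boundary equations A_0 + A_1 = k, A_(t-2) + U = k, and A_(t-1) + B_(t-1) = k at the apex.  These force
-- A_c = B_c = U for every c.  Hence the sum N (N + 1) / 2 of all labels equals (2t + 1) U ≤ (2t + 1) N,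
-- which gives m + n ≤ 4; and a part with one vertex per level would repeat the apex label, so m, n ≥ 2.
-- Conversely, for K_{2,2} split the labels 1, …, 4t into four blocks of t consecutive labels; giving the two
-- vertices of a part at level i the i-th label of one block and the (t - 1 - i)-th label of the complementary
-- block makes every level sum equal to 4t + 1, the label of the apex.
module Submission where

open import Defs
open import Data.Nat using (ℕ; zero; suc; _≤_; _<_; _+_; _*_; _≡ᵇ_; _≟_; z≤n; s≤s; NonZero)
open import Data.Nat.Properties
open import Data.Nat.Tactic.RingSolver using (solve-∀)
import Data.Nat.ListAction as List
open import Data.Bool using (Bool; true; false; _∧_; _∨_; if_then_else_)
import Data.Bool as Bool
open import Data.Fin using (Fin; toℕ; fromℕ<; opposite; _↑ˡ_; _↑ʳ_; combine; splitAt; quotRem)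
  renaming (zero to fzero; suc to fsuc)
open import Data.Fin.Patterns using (0F; 1F; 2F; 3F)
open import Data.Fin.Properties
  using (toℕ<n; toℕ-fromℕ<; toℕ-injective; opposite-prop; opposite-involutive; +↔⊎; *↔×; toℕ-↑ˡ; toℕ-↑ʳ;
         toℕ-combine; splitAt-↑ˡ; splitAt-↑ʳ; join-splitAt; remQuot-combine; combine-remQuot)
open import Data.List using ([]; _∷_; map; filter; allFin; tabulate)
open import Data.List.Properties using (map-tabulate)
open import Data.Product using (_×_; _,_; proj₁; proj₂; uncurry)
open import Data.Sum using (_⊎_; inj₁; inj₂)
open import Data.Sum.Function.Propositional using (_⊎-↔_)
open import Function.Bundles using (_⇔_; _↔_; _⤖_; mk⇔; mk↔ₛ′; Equivalence; Inverse; Bijection)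
open import Function.Construct.Composition using (_⇔-∘_)
open import Function.Construct.Identity using (⇔-id)
open import Function.Construct.Symmetry using (⇔-sym)
open import Function.Properties.Bijection using (⤖⇒↔)
open import Function.Properties.Inverse using (↔-refl; ↔-sym; ↔-trans; ↔⇒⤖)
open import Relation.Nullary.Decidable using (⌊_⌋; isYes≗does)
open import Relation.Binary.PropositionalEquality
open import Algebra.Properties.CommutativeMonoid.Sum +-0-commutativeMonoid
  using (sum; sum-syntax; sum-cong-≗; ∑-distrib-+; ∑-comm; sum-permute; sum-replicate-zero)

when : Bool → ℕ → ℕ
when b x = if b then x else 0

sum-when : ∀ {n} b (h : Fin n → ℕ) → sum (λ i → when b (h i)) ≡ when b (sum h)
sum-when     true  h = refl
sum-when {n} false h = sum-replicate-zero n

sum-↑ : ∀ a b (h : Fin (a + b) → ℕ) → sum h ≡ sum (λ i → h (i ↑ˡ b)) + sum (λ j → h (a ↑ʳ j))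
sum-↑ zero    b h = refl
sum-↑ (suc a) b h = trans (cong (h fzero +_) (sum-↑ a b (λ i → h (fsuc i)))) (sym (+-assoc (h fzero) _ _))

sum-combine : ∀ a t (h : Fin (a * t) → ℕ) → sum h ≡ sum (λ x → sum (λ i → h (combine {a} {t} x i)))
sum-combine zero    t h = refl
sum-combine (suc a) t h =
  trans (sum-↑ t (a * t) h) (cong (sum (λ i → h (i ↑ˡ a * t)) +_) (sum-combine a t (λ w → h (t ↑ʳ w))))

sum-const : ∀ n c → sum {n} (λ _ → c) ≡ n * c
sum-const zero    c = refl
sum-const (suc n) c = cong (c +_) (sum-const n c)

sum-offset-labels : ∀ N a → 2 * ∑[ w < N ] (a + suc (toℕ w)) ≡ N * (2 * a + suc N)
sum-offset-labels zero    a = refl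
sum-offset-labels (suc N) a = begin
  2 * ((a + 1) + ∑[ w < N ] (a + suc (suc (toℕ w))))
    ≡⟨ *-distribˡ-+ 2 (a + 1) _ ⟩
  2 * (a + 1) + 2 * ∑[ w < N ] (a + suc (suc (toℕ w)))
    ≡⟨ cong (λ z → 2 * (a + 1) + 2 * z) (sum-cong-≗ {N} (λ w → +-suc a (suc (toℕ w)))) ⟩
  2 * (a + 1) + 2 * ∑[ w < N ] (suc a + suc (toℕ w))
    ≡⟨ cong (2 * (a + 1) +_) (sum-offset-labels N (suc a)) ⟩
  2 * (a + 1) + N * (2 * suc a + suc N)
    ≡⟨ step a N ⟩
  suc N * (2 * a + suc (suc N))
    ∎
  where
  open ≡-Reasoning
  step : ∀ a N → 2 * (a + 1) + N * (2 * suc a + suc N) ≡ suc N * (2 * a + suc (suc N))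
  step = solve-∀

sum-labels : ∀ N → 2 * ∑[ w < N ] suc (toℕ w) ≡ N * suc N
sum-labels N = sum-offset-labels N 0

sum-filter : ∀ {A : Set} (p : A → Bool) (g : A → ℕ) xs →
  List.sum (map g (filter (λ w → p w Bool.≟ true) xs)) ≡ List.sum (map (λ w → when (p w) (g w)) xs)
sum-filter p g []       = refl
sum-filter p g (x ∷ xs) with p x
... | true  = cong (g x +_) (sum-filter p g xs)
... | false = sum-filter p g xs

sum-tabulate : ∀ {n} (h : Fin n → ℕ) → List.sum (tabulate h) ≡ sum h
sum-tabulate {zero}  h = refl
sum-tabulate {suc n} h = cong (h fzero +_) (sum-tabulate (λ i → h (fsuc i)))

nbrSum≡sum : ∀ N adj g v → nbrSum N adj g v ≡ ∑[ w < N ] when (adj v w) (g w)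
nbrSum≡sum N adj g v = begin
  nbrSum N adj g v
    ≡⟨ sum-filter (adj v) g (allFin N) ⟩
  List.sum (map (λ w → when (adj v w) (g w)) (allFin N))
    ≡⟨ cong List.sum (map-tabulate {n = N} (λ w → w) (λ w → when (adj v w) (g w))) ⟩
  List.sum (tabulate (λ w → when (adj v w) (g w)))
    ≡⟨ sum-tabulate {N} _ ⟩
  ∑[ w < N ] when (adj v w) (g w)
    ∎
  where open ≡-Reasoning

∑∑-when : ∀ {a t} (b : Fin a → Fin t → Bool) (β : Fin t → Bool) (h : Fin a → Fin t → ℕ) →
  (∀ p j → b p j ≡ β j) → ∑[ p < a ] ∑[ j < t ] when (b p j) (h p j) ≡ ∑[ j < t ] when (β j) (∑[ p < a ] h p j)
∑∑-when {a} {t} b β h b≡β = begin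
  ∑[ p < a ] ∑[ j < t ] when (b p j) (h p j) ≡⟨ sum-cong-≗ (λ p → sum-cong-≗ (λ j → cong (λ c → when c (h p j)) (b≡β p j))) ⟩
  ∑[ p < a ] ∑[ j < t ] when (β j) (h p j)   ≡⟨ ∑-comm (λ p j → when (β j) (h p j)) ⟩
  ∑[ j < t ] ∑[ p < a ] when (β j) (h p j)   ≡⟨ sum-cong-≗ (λ j → sum-when (β j) (λ p → h p j)) ⟩
  ∑[ j < t ] when (β j) (∑[ p < a ] h p j)   ∎
  where open ≡-Reasoning

⌊≟⌋≡≡ᵇ : ∀ a b → ⌊ a ≟ b ⌋ ≡ (a ≡ᵇ b)
⌊≟⌋≡≡ᵇ a b = isYes≗does (a ≟ b)

≡ᵇ-refl : ∀ a → (a ≡ᵇ a) ≡ true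
≡ᵇ-refl zero    = refl
≡ᵇ-refl (suc a) = ≡ᵇ-refl a

<⇒≡ᵇ-false : ∀ {a b} → a < b → (a ≡ᵇ b) ≡ false
<⇒≡ᵇ-false {zero}  {suc b} _         = refl
<⇒≡ᵇ-false {suc a} {suc b} (s≤s a<b) = <⇒≡ᵇ-false a<b

-- Adjacency of the levels of M_t(G) along an edge of G: a path on 0, …, t-1 with a loop at level 0.
levelAdj : ℕ → ℕ → Bool
levelAdj i j = ((i ≡ᵇ 0) ∧ (j ≡ᵇ 0)) ∨ ((suc i ≡ᵇ j) ∨ (suc j ≡ᵇ i))

levelAdj-⌊≟⌋ : ∀ a b → (⌊ a ≟ 0 ⌋ ∧ ⌊ b ≟ 0 ⌋) ∨ (⌊ suc a ≟ b ⌋ ∨ ⌊ suc b ≟ a ⌋) ≡ levelAdj a b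
levelAdj-⌊≟⌋ a b rewrite ⌊≟⌋≡≡ᵇ a 0 | ⌊≟⌋≡≡ᵇ b 0 | ⌊≟⌋≡≡ᵇ (suc a) b | ⌊≟⌋≡≡ᵇ (suc b) a = refl

pad : ∀ {t} → (Fin t → ℕ) → ℕ → ℕ
pad s c = ∑[ j < _ ] when (toℕ j ≡ᵇ c) (s j)

pad-toℕ : ∀ {t} (s : Fin t → ℕ) i → pad s (toℕ i) ≡ s i
pad-toℕ {suc t} s fzero    = trans (cong (s fzero +_) (sum-replicate-zero t)) (+-identityʳ _)
pad-toℕ {suc t} s (fsuc i) = pad-toℕ (λ j → s (fsuc j)) i

pad-≥ : ∀ {t} (s : Fin t → ℕ) c → t ≤ c → pad s c ≡ 0
pad-≥ {zero}  s c       _         = refl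
pad-≥ {suc t} s (suc c) (s≤s t≤c) = pad-≥ (λ j → s (fsuc j)) c t≤c

levelNbr : ∀ {t} → (Fin t → ℕ) → ℕ → ℕ
levelNbr s c = ∑[ j < _ ] when (levelAdj c (toℕ j)) (s j)

when-levelAdj-zero : ∀ j x → when (levelAdj 0 j) x ≡ when (j ≡ᵇ 0) x + when (j ≡ᵇ 1) x
when-levelAdj-zero zero          x = sym (+-identityʳ x)
when-levelAdj-zero (suc zero)    x = refl
when-levelAdj-zero (suc (suc j)) x = refl

when-levelAdj-suc : ∀ c j x → when (levelAdj (suc c) j) x ≡ when (j ≡ᵇ suc (suc c)) x + when (j ≡ᵇ c) x
when-levelAdj-suc c       zero                x = refl
when-levelAdj-suc zero    (suc zero)          x = refl
when-levelAdj-suc zero    (suc (suc zero))    x = sym (+-identityʳ x)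
when-levelAdj-suc zero    (suc (suc (suc j))) x = refl
when-levelAdj-suc (suc c) (suc j)             x = when-levelAdj-suc c j x

levelNbr-zero : ∀ {t} (s : Fin t → ℕ) → levelNbr s 0 ≡ pad s 0 + pad s 1
levelNbr-zero {t} s = trans (sum-cong-≗ {t} (λ j → when-levelAdj-zero (toℕ j) (s j))) (∑-distrib-+ {t} _ _)

levelNbr-suc : ∀ {t} (s : Fin t → ℕ) c → levelNbr s (suc c) ≡ pad s (suc (suc c)) + pad s c
levelNbr-suc {t} s c = trans (sum-cong-≗ {t} (λ j → when-levelAdj-suc c (toℕ j) (s j))) (∑-distrib-+ {t} _ _)

pad-below : ∀ {t U} (s : Fin t → ℕ) → (∀ i → s i ≡ U) → ∀ c → c < t → pad s c ≡ U
pad-below s s≡U c c<t = trans (cong (pad s) (sym (toℕ-fromℕ< c<t))) (trans (pad-toℕ s (fromℕ< c<t)) (s≡U _))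

+-cancel⇔ : ∀ {a b c d} → a + b ≡ c + d → (a ≡ c ⇔ b ≡ d)
+-cancel⇔ {a} {b} {c} {d} e = mk⇔ (λ { refl → +-cancelˡ-≡ a b d e }) (λ { refl → +-cancelʳ-≡ b a c e })

double≡+⇒≡ : ∀ {z a b} → z + z ≡ a + b → z ≡ a ⊎ z ≡ b → a ≡ b
double≡+⇒≡ {a = a} e (inj₁ refl) = +-cancelˡ-≡ a _ _ e
double≡+⇒≡ {b = b} e (inj₂ refl) = sym (+-cancelʳ-≡ b _ _ e)

-- The magic equations at the levels 0, …, r+1 of one side, in terms of the level sums x of the other side.
record LevelEquations (k r : ℕ) (x : ℕ → ℕ) : Set where
  field
    first : x 0 + x 1 ≡ k
    inner : ∀ c → c ≤ r → x (2 + c) + x c ≡ k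

module _ {k r : ℕ} where
  open LevelEquations

  levelEquations-values : ∀ {x} → LevelEquations k r x → ∀ c → c ≤ 2 + r → x c ≡ x 0 ⊎ x c ≡ x 1
  levelEquations-values         eqs zero          _               = inj₁ refl
  levelEquations-values         eqs (suc zero)    _               = inj₂ refl
  levelEquations-values {x = x} eqs (suc (suc c)) (s≤s (s≤s c≤r))
    with levelEquations-values eqs c (m≤n⇒m≤o+n 2 c≤r)
  ... | inj₁ xc≡x0 = inj₂ (+-cancelʳ-≡ (x 0) _ _ (begin
    x (2 + c) + x 0 ≡⟨ cong (x (2 + c) +_) xc≡x0 ⟨
    x (2 + c) + x c ≡⟨ trans (inner eqs c c≤r) (sym (first eqs)) ⟩
    x 0 + x 1       ≡⟨ +-comm (x 0) (x 1) ⟩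
    x 1 + x 0       ∎))
    where open ≡-Reasoning
  ... | inj₂ xc≡x1 = inj₁ (+-cancelʳ-≡ (x 1) _ _ (begin
    x (2 + c) + x 1 ≡⟨ cong (x (2 + c) +_) xc≡x1 ⟨
    x (2 + c) + x c ≡⟨ trans (inner eqs c c≤r) (sym (first eqs)) ⟩
    x 0 + x 1       ∎))
    where open ≡-Reasoning

  levelEquations-agree⇔ : ∀ {x y} → LevelEquations k r x → LevelEquations k r y →
                          ∀ c → c ≤ 2 + r → (x c ≡ y c ⇔ x 0 ≡ y 0)
  levelEquations-agree⇔ ex ey zero          _ = ⇔-id _
  levelEquations-agree⇔ ex ey (suc zero)    _ = ⇔-sym (+-cancel⇔ (trans (first ex) (sym (first ey))))
  levelEquations-agree⇔ ex ey (suc (suc c)) (s≤s (s≤s c≤r)) =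
    levelEquations-agree⇔ ex ey c (m≤n⇒m≤o+n 2 c≤r) ⇔-∘ (+-cancel⇔ (trans (inner ex c c≤r) (sym (inner ey c c≤r))))

  -- The equations at the last level (with the apex label U) and at the apex force every level sum to be U.
  levelEquations-constant : ∀ {U x y} → LevelEquations k r x → LevelEquations k r y →
    x (suc r) + U ≡ k → y (suc r) + U ≡ k → x (2 + r) + y (2 + r) ≡ k →
    ∀ c → c ≤ 2 + r → x c ≡ U × y c ≡ U
  levelEquations-constant {U} {x} {y} ex ey x-last y-last apex c c≤ = trans (x≡y c c≤) (y≡U c c≤) , y≡U c c≤
    where
    x0≡y0 : x 0 ≡ y 0
    x0≡y0 = Equivalence.to (levelEquations-agree⇔ ex ey (suc r) (n≤1+n _))
                           (+-cancelʳ-≡ U _ _ (trans x-last (sym y-last)))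
    x≡y : ∀ c → c ≤ 2 + r → x c ≡ y c
    x≡y c c≤ = Equivalence.from (levelEquations-agree⇔ ex ey c c≤) x0≡y0
    y0≡y1 : y 0 ≡ y 1
    y0≡y1 = double≡+⇒≡ (trans (cong (_+ y (2 + r)) (sym (x≡y (2 + r) ≤-refl))) (trans apex (sym (first ey))))
                       (levelEquations-values ey (2 + r) ≤-refl)
    y≡y0 : ∀ c → c ≤ 2 + r → y c ≡ y 0
    y≡y0 c c≤ with levelEquations-values ey c c≤
    ... | inj₁ e = e
    ... | inj₂ e = trans e (sym y0≡y1)
    U≡y0 : U ≡ y 0
    U≡y0 = +-cancelˡ-≡ (y 0) _ _ (begin
      y 0 + U       ≡⟨ cong (_+ U) (y≡y0 (suc r) (n≤1+n _)) ⟨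
      y (suc r) + U ≡⟨ trans y-last (sym (first ey)) ⟩
      y 0 + y 1     ≡⟨ cong (y 0 +_) y0≡y1 ⟨
      y 0 + y 0     ∎)
      where open ≡-Reasoning
    y≡U : ∀ c → c ≤ 2 + r → y c ≡ U
    y≡U c c≤ = trans (y≡y0 c c≤) (sym U≡y0)

levelEquations-of : ∀ {k r U} (s : Fin (3 + r) → ℕ) →
  (∀ i → levelNbr s (toℕ i) + when (suc (toℕ i) ≡ᵇ 3 + r) U ≡ k) →
  LevelEquations k r (pad s) × pad s (suc r) + U ≡ k
levelEquations-of {k} {r} {U} s eqs = record { first = first ; inner = inner } , last
  where
  equationAt : ∀ c → c < 3 + r → levelNbr s c + when (suc c ≡ᵇ 3 + r) U ≡ k
  equationAt c c<t = subst (λ c → levelNbr s c + when (suc c ≡ᵇ 3 + r) U ≡ k) (toℕ-fromℕ< c<t) (eqs (fromℕ< c<t))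
  first : pad s 0 + pad s 1 ≡ k
  first = trans (sym (trans (cong (_+ 0) (levelNbr-zero s)) (+-identityʳ _))) (equationAt 0 (s≤s z≤n))
  inner : ∀ c → c ≤ r → pad s (2 + c) + pad s c ≡ k
  inner c c≤r = begin
    pad s (2 + c) + pad s c                                  ≡⟨ +-identityʳ _ ⟨
    pad s (2 + c) + pad s c + 0                              ≡⟨ cong (λ b → pad s (2 + c) + pad s c + when b U) (<⇒≡ᵇ-false (s≤s c≤r)) ⟨
    pad s (2 + c) + pad s c + when (c ≡ᵇ suc r) U            ≡⟨ cong (_+ when (c ≡ᵇ suc r) U) (levelNbr-suc s c) ⟨
    levelNbr s (suc c) + when (2 + c ≡ᵇ 3 + r) U             ≡⟨ equationAt (suc c) (s≤s (s≤s (m≤n⇒m≤1+n c≤r))) ⟩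
    k                                                        ∎
    where open ≡-Reasoning
  last : pad s (suc r) + U ≡ k
  last = begin
    0 + pad s (suc r) + U                                    ≡⟨ cong (λ z → z + pad s (suc r) + U) (pad-≥ s (3 + r) ≤-refl) ⟨
    pad s (3 + r) + pad s (suc r) + U                        ≡⟨ cong (λ b → pad s (3 + r) + pad s (suc r) + when b U) (≡ᵇ-refl r) ⟨
    pad s (3 + r) + pad s (suc r) + when (3 + r ≡ᵇ 3 + r) U  ≡⟨ cong (_+ when (3 + r ≡ᵇ 3 + r) U) (levelNbr-suc s (suc r)) ⟨
    levelNbr s (2 + r) + when (3 + r ≡ᵇ 3 + r) U             ≡⟨ equationAt (2 + r) ≤-refl ⟩
    k                                                        ∎
    where open ≡-Reasoning

pad-above+apex : ∀ {t U} (s : Fin t → ℕ) → (∀ i → s i ≡ U) → ∀ c → c < t → pad s (suc c) + when (suc c ≡ᵇ t) U ≡ U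
pad-above+apex {t} {U} s s≡U c c<t with m≤n⇒m<n∨m≡n c<t
... | inj₁ 1+c<t = trans (cong₂ _+_ (pad-below s s≡U (suc c) 1+c<t) (cong (λ b → when b U) (<⇒≡ᵇ-false 1+c<t))) (+-identityʳ U)
... | inj₂ refl  = cong₂ _+_ (pad-≥ s (suc c) ≤-refl) (cong (λ b → when b U) (≡ᵇ-refl (suc c)))

-- In the Mycielskian each level has, counting the apex, exactly two neighbouring levels.
levelNbr-constant : ∀ {t U} (s : Fin t → ℕ) → (∀ i → s i ≡ U) → ∀ c → c < t → levelNbr s c + when (suc c ≡ᵇ t) U ≡ U + U
levelNbr-constant {t} {U} s s≡U zero 0<t = begin
  levelNbr s 0 + when (1 ≡ᵇ t) U        ≡⟨ cong (_+ when (1 ≡ᵇ t) U) (levelNbr-zero s) ⟩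
  pad s 0 + pad s 1 + when (1 ≡ᵇ t) U   ≡⟨ +-assoc (pad s 0) _ _ ⟩
  pad s 0 + (pad s 1 + when (1 ≡ᵇ t) U) ≡⟨ cong₂ _+_ (pad-below s s≡U 0 0<t) (pad-above+apex s s≡U 0 0<t) ⟩
  U + U                                 ∎
  where open ≡-Reasoning
levelNbr-constant {t} {U} s s≡U (suc c) 1+c<t = begin
  levelNbr s (suc c) + when (2 + c ≡ᵇ t) U             ≡⟨ cong (_+ when (2 + c ≡ᵇ t) U) (levelNbr-suc s c) ⟩
  pad s (2 + c) + pad s c + when (2 + c ≡ᵇ t) U        ≡⟨ +-assoc (pad s (2 + c)) _ _ ⟩
  pad s (2 + c) + (pad s c + when (2 + c ≡ᵇ t) U)      ≡⟨ cong (pad s (2 + c) +_) (+-comm (pad s c) _) ⟩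
  pad s (2 + c) + (when (2 + c ≡ᵇ t) U + pad s c)      ≡⟨ +-assoc (pad s (2 + c)) _ _ ⟨
  pad s (2 + c) + when (2 + c ≡ᵇ t) U + pad s c        ≡⟨ cong₂ _+_ (pad-above+apex s s≡U (suc c) 1+c<t) (pad-below s s≡U c (<⇒≤ 1+c<t)) ⟩
  U + U                                                ∎
  where open ≡-Reasoning

apex-level : ∀ {t U} (s : Fin t → ℕ) → (∀ i → s i ≡ U) → 0 < t → ∑[ j < t ] when (suc (toℕ j) ≡ᵇ t) (s j) ≡ U
apex-level {suc t} s s≡U _ = pad-below s s≡U t ≤-refl

-- Comparing N (N + 1) = 2 (2t + 1) U with U ≤ N gives N + 1 ≤ 4t + 2.
magicSum⇒size≤4 : ∀ s t U .{{_ : NonZero t}} → U ≤ s * t + 1 →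
  (s * t + 1) * suc (s * t + 1) ≡ 2 * (t * (U + U) + U) → s ≤ 4
magicSum⇒size≤4 s t U U≤N magic = *-cancelʳ-≤ s 4 t (≤-pred (≤-pred (*-cancelˡ-≤ (suc (s * t)) bound)))
  where
  open ≤-Reasoning
  bound : suc (s * t) * suc (suc (s * t)) ≤ suc (s * t) * suc (suc (4 * t))
  bound = begin
    suc (s * t) * suc (suc (s * t))  ≡⟨ cong (λ z → z * suc z) (+-comm 1 (s * t)) ⟩
    (s * t + 1) * suc (s * t + 1)    ≡⟨ magic ⟩
    2 * (t * (U + U) + U)            ≡⟨ identity t U ⟩
    suc (suc (4 * t)) * U            ≤⟨ *-monoʳ-≤ (suc (suc (4 * t))) U≤N ⟩
    suc (suc (4 * t)) * (s * t + 1)  ≡⟨ *-comm _ (s * t + 1) ⟩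
    (s * t + 1) * suc (suc (4 * t))  ≡⟨ cong (_* suc (suc (4 * t))) (+-comm (s * t) 1) ⟩
    suc (s * t) * suc (suc (4 * t))  ∎
    where
    identity : ∀ t U → 2 * (t * (U + U) + U) ≡ suc (suc (4 * t)) * U
    identity = solve-∀

size≤4⇒2,2 : ∀ {m n} → 2 ≤ m → 2 ≤ n → m + n ≤ 4 → m ≡ 2 × n ≡ 2
size≤4⇒2,2 {m} {n} 2≤m 2≤n m+n≤4 =
  ≤-antisym (+-cancelʳ-≤ 2 m 2 (≤-trans (+-monoʳ-≤ m 2≤n) m+n≤4)) 2≤m ,
  ≤-antisym (+-cancelˡ-≤ 2 n 2 (≤-trans (+-monoˡ-≤ n 2≤m) m+n≤4)) 2≤n

opposite-labels : ∀ {t} x y (i : Fin t) → suc (t * x + toℕ i) + suc (t * y + toℕ (opposite i)) ≡ t * suc (x + y) + 1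
opposite-labels {t} x y i = complementary (toℕ i) (toℕ (opposite i)) (trans (cong (suc (toℕ i) +_) (opposite-prop i)) (m+[n∸m]≡n (toℕ<n i)))
  where
  complementary : ∀ a b → suc a + b ≡ t → suc (t * x + a) + suc (t * y + b) ≡ t * suc (x + y) + 1
  complementary a b refl = identity a b x y
    where
    identity : ∀ a b x y → suc ((suc a + b) * x + a) + suc ((suc a + b) * y + b) ≡ (suc a + b) * suc (x + y) + 1
    identity = solve-∀

module MycielskianK (m n t : ℕ) where

  N : ℕ
  N = (m + n) * t + 1

  vertex : Fin (m + n) → Fin t → Fin N
  vertex x i = combine x i ↑ˡ 1

  apex : Fin N
  apex = (m + n) * t ↑ʳ fzero

  vertexA : Fin m → Fin t → Fin N
  vertexA p = vertex (p ↑ˡ n)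

  vertexB : Fin n → Fin t → Fin N
  vertexB q = vertex (m ↑ʳ q)

  data Vertex : Fin N → Set where
    inA    : ∀ p i → Vertex (vertexA p i)
    inB    : ∀ q i → Vertex (vertexB q i)
    isApex : Vertex apex

  vertex-view : ∀ v → Vertex v
  vertex-view v with splitAt ((m + n) * t) v | join-splitAt ((m + n) * t) 1 v
  ... | inj₂ fzero | refl = isApex
  ... | inj₁ c     | refl with quotRem {m + n} t c | combine-remQuot {m + n} t c
  ...   | i , x | refl with splitAt m x | join-splitAt m n x
  ...     | inj₁ p | refl = inA p i
  ...     | inj₂ q | refl = inB q i

  decodeM-vertex : ∀ x i → decodeM (m + n) t (vertex x i) ≡ lay x i
  decodeM-vertex x i rewrite splitAt-↑ˡ ((m + n) * t) (combine x i) 1 = cong (uncurry lay) (remQuot-combine x i)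

  decodeM-apex : decodeM (m + n) t apex ≡ top
  decodeM-apex rewrite splitAt-↑ʳ ((m + n) * t) 1 fzero = refl

  vertex≢apex : ∀ x i → vertex x i ≢ apex
  vertex≢apex x i eq with trans (sym (decodeM-vertex x i)) (trans (cong (decodeM (m + n) t) eq) decodeM-apex)
  ... | ()

  isLast : Fin t → Bool
  isLast i = suc (toℕ i) ≡ᵇ t

  MK-vertex : ∀ x i y j → MK t m n (vertex x i) (vertex y j) ≡ MadjV (m + n) t (Kadj m n) (lay x i) (lay y j)
  MK-vertex x i y j = cong₂ (MadjV (m + n) t (Kadj m n)) (decodeM-vertex x i) (decodeM-vertex y j)

  MK-AA : ∀ p i q j → MK t m n (vertexA p i) (vertexA q j) ≡ false
  MK-AA p i q j rewrite MK-vertex (p ↑ˡ n) i (q ↑ˡ n) j | splitAt-↑ˡ m p n | splitAt-↑ˡ m q n = refl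

  MK-BB : ∀ p i q j → MK t m n (vertexB p i) (vertexB q j) ≡ false
  MK-BB p i q j rewrite MK-vertex (m ↑ʳ p) i (m ↑ʳ q) j | splitAt-↑ʳ m n p | splitAt-↑ʳ m n q = refl

  MK-AB : ∀ p i q j → MK t m n (vertexA p i) (vertexB q j) ≡ levelAdj (toℕ i) (toℕ j)
  MK-AB p i q j rewrite MK-vertex (p ↑ˡ n) i (m ↑ʳ q) j | splitAt-↑ˡ m p n | splitAt-↑ʳ m n q =
    levelAdj-⌊≟⌋ (toℕ i) (toℕ j)

  MK-BA : ∀ q i p j → MK t m n (vertexB q i) (vertexA p j) ≡ levelAdj (toℕ i) (toℕ j)
  MK-BA q i p j rewrite MK-vertex (m ↑ʳ q) i (p ↑ˡ n) j | splitAt-↑ˡ m p n | splitAt-↑ʳ m n q =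
    levelAdj-⌊≟⌋ (toℕ i) (toℕ j)

  MK-vertex-apex : ∀ x i → MK t m n (vertex x i) apex ≡ isLast i
  MK-vertex-apex x i rewrite decodeM-vertex x i | decodeM-apex = ⌊≟⌋≡≡ᵇ (suc (toℕ i)) t

  MK-apex-vertex : ∀ x i → MK t m n apex (vertex x i) ≡ isLast i
  MK-apex-vertex x i rewrite decodeM-vertex x i | decodeM-apex = ⌊≟⌋≡≡ᵇ (suc (toℕ i)) t

  MK-apex-apex : MK t m n apex apex ≡ false
  MK-apex-apex rewrite decodeM-apex = refl

  sum-vertices : (h : Fin N → ℕ) →
    sum h ≡ (∑[ p < m ] ∑[ i < t ] h (vertexA p i) + ∑[ q < n ] ∑[ i < t ] h (vertexB q i)) + h apex
  sum-vertices h = begin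
    sum h                                                       ≡⟨ sum-↑ ((m + n) * t) 1 h ⟩
    ∑[ c < (m + n) * t ] h (c ↑ˡ 1) + (h apex + 0)              ≡⟨ cong₂ _+_ (sum-combine (m + n) t (λ c → h (c ↑ˡ 1))) (+-identityʳ _) ⟩
    ∑[ x < m + n ] ∑[ i < t ] h (vertex x i) + h apex           ≡⟨ cong (_+ h apex) (sum-↑ m n (λ x → ∑[ i < t ] h (vertex x i))) ⟩
    (∑[ p < m ] ∑[ i < t ] h (vertexA p i) + ∑[ q < n ] ∑[ i < t ] h (vertexB q i)) + h apex ∎
    where open ≡-Reasoning

  module Labelled (g : Fin N → ℕ) where

    layerA : Fin t → ℕ
    layerA i = ∑[ p < m ] g (vertexA p i)

    layerB : Fin t → ℕ
    layerB i = ∑[ q < n ] g (vertexB q i)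

    nbrSum-layers : ∀ v (α β : Fin t → Bool) γ →
      (∀ p j → MK t m n v (vertexA p j) ≡ α j) → (∀ q j → MK t m n v (vertexB q j) ≡ β j) → MK t m n v apex ≡ γ →
      nbrSum N (MK t m n) g v ≡ (∑[ j < t ] when (α j) (layerA j) + ∑[ j < t ] when (β j) (layerB j)) + when γ (g apex)
    nbrSum-layers v α β γ adjA adjB adjApex = begin
      nbrSum N (MK t m n) g v
        ≡⟨ nbrSum≡sum N (MK t m n) g v ⟩
      ∑[ w < N ] when (MK t m n v w) (g w)
        ≡⟨ sum-vertices _ ⟩
      (∑[ p < m ] ∑[ j < t ] when (MK t m n v (vertexA p j)) (g (vertexA p j)) +
       ∑[ q < n ] ∑[ j < t ] when (MK t m n v (vertexB q j)) (g (vertexB q j))) + when (MK t m n v apex) (g apex)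
        ≡⟨ cong₂ _+_ (cong₂ _+_ (∑∑-when _ α _ adjA) (∑∑-when _ β _ adjB)) (cong (λ b → when b (g apex)) adjApex) ⟩
      (∑[ j < t ] when (α j) (layerA j) + ∑[ j < t ] when (β j) (layerB j)) + when γ (g apex) ∎
      where open ≡-Reasoning

    nbrSum-vertexA : ∀ p i → nbrSum N (MK t m n) g (vertexA p i) ≡ levelNbr layerB (toℕ i) + when (isLast i) (g apex)
    nbrSum-vertexA p i =
      trans (nbrSum-layers (vertexA p i) (λ _ → false) (λ j → levelAdj (toℕ i) (toℕ j)) (isLast i)
                           (MK-AA p i) (MK-AB p i) (MK-vertex-apex (p ↑ˡ n) i))
            (cong (λ z → z + levelNbr layerB (toℕ i) + when (isLast i) (g apex)) (sum-replicate-zero t))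

    nbrSum-vertexB : ∀ q i → nbrSum N (MK t m n) g (vertexB q i) ≡ levelNbr layerA (toℕ i) + when (isLast i) (g apex)
    nbrSum-vertexB q i =
      trans (nbrSum-layers (vertexB q i) (λ j → levelAdj (toℕ i) (toℕ j)) (λ _ → false) (isLast i)
                           (MK-BA q i) (MK-BB q i) (MK-vertex-apex (m ↑ʳ q) i))
            (cong (_+ when (isLast i) (g apex))
                  (trans (cong (levelNbr layerA (toℕ i) +_) (sum-replicate-zero t)) (+-identityʳ _)))

    nbrSum-apex : nbrSum N (MK t m n) g apex ≡ ∑[ j < t ] when (isLast j) (layerA j) + ∑[ j < t ] when (isLast j) (layerB j)
    nbrSum-apex =
      trans (nbrSum-layers apex isLast isLast false
                           (λ p → MK-apex-vertex (p ↑ˡ n)) (λ q → MK-apex-vertex (m ↑ʳ q)) MK-apex-apex)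
            (+-identityʳ _)

    sum-layers : sum g ≡ ∑[ i < t ] (layerA i + layerB i) + g apex
    sum-layers = trans (sum-vertices g)
      (cong (_+ g apex) (trans (cong₂ _+_ (∑-comm (λ p i → g (vertexA p i))) (∑-comm (λ q i → g (vertexB q i))))
                               (sym (∑-distrib-+ layerA layerB))))

module MagicLabelling (r m n : ℕ) (f : Fin ((suc m + suc n) * (3 + r) + 1) ⤖ Fin ((suc m + suc n) * (3 + r) + 1)) (k : ℕ)
  (magic : ∀ v → nbrSum _ (MK (3 + r) (suc m) (suc n)) (λ w → suc (toℕ (Bijection.to f w))) v ≡ k) where

  open MycielskianK (suc m) (suc n) (3 + r)

  label : Fin N → ℕ
  label w = suc (toℕ (Bijection.to f w))

  open Labelled label

  label-injective : ∀ {v w} → label v ≡ label w → v ≡ w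
  label-injective eq = Bijection.injective f (toℕ-injective (suc-injective eq))

  equationsA : ∀ i → levelNbr layerA (toℕ i) + when (suc (toℕ i) ≡ᵇ 3 + r) (label apex) ≡ k
  equationsA i = trans (sym (nbrSum-vertexB fzero i)) (magic (vertexB fzero i))

  equationsB : ∀ i → levelNbr layerB (toℕ i) + when (suc (toℕ i) ≡ᵇ 3 + r) (label apex) ≡ k
  equationsB i = trans (sym (nbrSum-vertexA fzero i)) (magic (vertexA fzero i))

  equationApex : pad layerA (2 + r) + pad layerB (2 + r) ≡ k
  equationApex = trans (sym nbrSum-apex) (magic apex)

  layers-constant : ∀ i → layerA i ≡ label apex × layerB i ≡ label apex
  layers-constant i =
    let eqsA , lastA = levelEquations-of {k} {r} {label apex} layerA equationsA
        eqsB , lastB = levelEquations-of {k} {r} {label apex} layerB equationsB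
        A≡U , B≡U = levelEquations-constant eqsA eqsB lastA lastB equationApex (toℕ i) (≤-pred (toℕ<n i))
    in trans (sym (pad-toℕ layerA i)) A≡U , trans (sym (pad-toℕ layerB i)) B≡U

  sum-label : sum label ≡ (3 + r) * (label apex + label apex) + label apex
  sum-label = begin
    sum label
      ≡⟨ sum-layers ⟩
    ∑[ i < 3 + r ] (layerA i + layerB i) + label apex
      ≡⟨ cong (_+ label apex) (sum-cong-≗ (λ i → cong₂ _+_ (proj₁ (layers-constant i)) (proj₂ (layers-constant i)))) ⟩
    ∑[ i < 3 + r ] (label apex + label apex) + label apex
      ≡⟨ cong (_+ label apex) (sum-const (3 + r) (label apex + label apex)) ⟩
    (3 + r) * (label apex + label apex) + label apex
      ∎
    where open ≡-Reasoning

  size≤4 : suc m + suc n ≤ 4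
  size≤4 = magicSum⇒size≤4 (suc m + suc n) (3 + r) (label apex) (toℕ<n (Bijection.to f apex)) (begin
    N * suc N                                                   ≡⟨ sum-labels N ⟨
    2 * ∑[ w < N ] suc (toℕ w)                                  ≡⟨ cong (2 *_) (sum-permute {N} (λ w → suc (toℕ w)) (⤖⇒↔ f)) ⟩
    2 * sum label                                               ≡⟨ cong (2 *_) sum-label ⟩
    2 * ((3 + r) * (label apex + label apex) + label apex)      ∎)
    where open ≡-Reasoning

  -- A single vertex per level on one side would carry the apex label.
  2≤m : 2 ≤ suc m
  2≤m = s≤s (n≢0⇒n>0 m≢0)
    where
    m≢0 : m ≢ 0
    m≢0 refl = vertex≢apex (fzero {0} ↑ˡ suc n) fzero (label-injective (trans (sym (+-identityʳ _)) (proj₁ (layers-constant fzero))))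

  2≤n : 2 ≤ suc n
  2≤n = s≤s (n≢0⇒n>0 n≢0)
    where
    n≢0 : n ≢ 0
    n≢0 refl = vertex≢apex (suc m ↑ʳ fzero) fzero (label-injective (trans (sym (+-identityʳ _)) (proj₂ (layers-constant fzero))))

distanceMagic⇒K22 : ∀ r m n → DistanceMagic ((suc m + suc n) * (3 + r) + 1) (MK (3 + r) (suc m) (suc n)) →
                    suc m ≡ 2 × suc n ≡ 2
distanceMagic⇒K22 r m n (f , k , magic) = size≤4⇒2,2 2≤m 2≤n size≤4
  where open MagicLabelling r m n f k magic

module K22Labelling (t : ℕ) (0<t : 0 < t) where
  open MycielskianK 2 2 t

  -- σ (x , i) is the block and the position in it of the label of vertex x at level i.
  σ : Fin 4 × Fin t → Fin 4 × Fin t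
  σ (0F , i) = 0F , i
  σ (1F , i) = 3F , opposite i
  σ (2F , i) = 2F , i
  σ (3F , i) = 1F , opposite i

  σ-involutive : ∀ p → σ (σ p) ≡ p
  σ-involutive (0F , i) = refl
  σ-involutive (1F , i) = cong (1F ,_) (opposite-involutive i)
  σ-involutive (2F , i) = refl
  σ-involutive (3F , i) = cong (3F ,_) (opposite-involutive i)

  labelling : Fin N ↔ Fin N
  labelling = ↔-trans +↔⊎ (↔-trans (↔-trans *↔× (↔-trans (mk↔ₛ′ σ σ σ-involutive σ-involutive) (↔-sym *↔×)) ⊎-↔ ↔-refl) (↔-sym +↔⊎))

  label : Fin N → ℕ
  label w = suc (toℕ (Inverse.to labelling w))

  label-vertex : ∀ x i → label (vertex x i) ≡ suc (t * toℕ (proj₁ (σ (x , i))) + toℕ (proj₂ (σ (x , i))))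
  label-vertex x i rewrite splitAt-↑ˡ (4 * t) (combine x i) 1 | remQuot-combine x i =
    cong suc (trans (toℕ-↑ˡ (combine (proj₁ (σ (x , i))) (proj₂ (σ (x , i)))) 1) (toℕ-combine (proj₁ (σ (x , i))) (proj₂ (σ (x , i)))))

  U : ℕ
  U = t * 4 + 1

  label-apex : label apex ≡ U
  label-apex rewrite splitAt-↑ʳ (4 * t) 1 fzero = trans (cong suc (toℕ-↑ʳ (4 * t) fzero)) (identity t)
    where
    identity : ∀ t → suc (4 * t + 0) ≡ t * 4 + 1
    identity = solve-∀

  open Labelled label

  layerA≡U : ∀ i → layerA i ≡ U
  layerA≡U i = trans (cong₂ (λ a b → a + (b + 0)) (label-vertex 0F i) (label-vertex 1F i))
                     (trans (cong (suc (t * 0 + toℕ i) +_) (+-identityʳ _)) (opposite-labels 0 3 i))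

  layerB≡U : ∀ i → layerB i ≡ U
  layerB≡U i = trans (cong₂ (λ a b → a + (b + 0)) (label-vertex 2F i) (label-vertex 3F i))
                     (trans (cong (suc (t * 2 + toℕ i) +_) (+-identityʳ _)) (opposite-labels 2 1 i))

  label-magic : ∀ v → nbrSum N (MK t 2 2) label v ≡ U + U
  label-magic v with vertex-view v
  ... | inA p i = trans (nbrSum-vertexA p i)
                        (trans (cong (λ u → levelNbr layerB (toℕ i) + when (isLast i) u) label-apex)
                               (levelNbr-constant layerB layerB≡U (toℕ i) (toℕ<n i)))
  ... | inB q i = trans (nbrSum-vertexB q i)
                        (trans (cong (λ u → levelNbr layerA (toℕ i) + when (isLast i) u) label-apex)
                               (levelNbr-constant layerA layerA≡U (toℕ i) (toℕ<n i)))
  ... | isApex  = trans nbrSum-apex (cong₂ _+_ (apex-level layerA layerA≡U 0<t) (apex-level layerB layerB≡U 0<t))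

K22-distanceMagic : ∀ t → 0 < t → DistanceMagic ((2 + 2) * t + 1) (MK t 2 2)
K22-distanceMagic t 0<t = ↔⇒⤖ labelling , U + U , label-magic
  where open K22Labelling t 0<t

theorem2p12 : (t m n : ℕ) → 3 ≤ t → 1 ≤ m → 1 ≤ n →
    (DistanceMagic ((m + n) * t + 1) (MK t m n) ⇔ (m ≡ 2 × n ≡ 2))
theorem2p12 _ _ _ (s≤s (s≤s (s≤s (z≤n {r})))) (s≤s (z≤n {m})) (s≤s (z≤n {n})) =
  mk⇔ (distanceMagic⇒K22 r m n) λ { (refl , refl) → K22-distanceMagic (3 + r) (s≤s z≤n) }
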